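{- Let $C_0 \ge 0$ be a constant and let $\mathcal{A}$ be a collection of pairwise non-parallel hyperplanes in $Q = S_1 \times \cdots \times S_n$ such that $\|F(A)\| > C_0$ for every $A \in \mathcal{A}$. Then for each integer $k \in [1, n]$, \[ E_{k-1} \le \frac{1}{|S_k|^2} \sum_{\substack{F_1, F_2 \subseteq \{1,\ldots,k-1\} \\ \|F_1\| > C_0/|S_k|,\ \|F_2\| > C_0/|S_k|}} \ \prod_{j \in F_1 \cup F_2} \frac{1}{(1-\delta_j)|S_j|}. \]
   Context: Let $S_1, S_2, \ldots$ be finite sets, each of size at least $2$, fix a positive integer $n$, and write $Q_k = S_1 \times \cdots \times S_k$ for $k \ge 1$, $Q = Q_n$, and let $Q_0$ consist of the single empty tuple. A hyperplane is a set $A = Y_1 \times \cdots \times Y_n$ with $Y_j \subseteq S_j$ and $|Y_j| \in \{1, |S_j|\}$ for each $j$; its set of fixed coordinates is $F(A) = \{ j : |Y_j| = 1\}$; two hyperplanes $A, A'$ are parallel if $F(A) = F(A')$. For a collection $\mathcal{A}$ of hyperplanes let $\mathcal{A}_k = \{A \in \mathcal{A} : \max F(A) = k\}$ and $B_k = \bigcup_{A \in \mathcal{A}_k} A$, regarded as a subset of $Q_k$ (its projection onto the first $k$ coordinates). Fix numbers $\delta_j \in [0, 1/2]$. Weights are defined inductively: $w_0$ gives the empty tuple weight $1$. For $1 \le k \le n$ and $x \in Q_{k-1}$ let $\alpha_k(x) = |\{ y \in S_k : (x,y) \in B_k\}| / |S_k|$. If $\alpha_k(x) \le \delta_k$, set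 $w_k(x,y) = 0$ if $(x,y) \in B_k$ and $w_k(x,y) = \frac{1}{1-\alpha_k(x)} \cdot \frac{w_{k-1}(x)}{|S_k|}$ if $(x,y) \notin B_k$. If $\alpha_k(x) > \delta_k$, set $w_k(x,y) = \frac{\alpha_k(x) - \delta_k}{\alpha_k(x)(1-\delta_k)} \cdot \frac{w_{k-1}(x)}{|S_k|}$ if $(x,y) \in B_k$ and $w_k(x,y) = \frac{1}{1-\delta_k} \cdot \frac{w_{k-1}(x)}{|S_k|}$ if $(x,y) \notin B_k$. Then $E_{k-1} = \sum_{x \in Q_{k-1}} \alpha_k(x)^2 w_{k-1}(x)$ (for $k=1$ this equals $(|B_1|/|S_1|)^2$). For $J \subseteq \{1,\ldots,n\}$, $\|J\| = \prod_{j\in J} |S_j|$ (empty product $=1$).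
   Formalization: The numbers $\delta_j$ and the constant $C_0$ take only rational values. -}

module Defs where

open import Data.Nat as ℕ using (ℕ; zero; suc)
open import Data.Nat.Properties as ℕP using ()
open import Data.Integer using (+_)
open import Data.Rational using (ℚ; 0ℚ; 1ℚ; _+_; _*_; _-_; _÷_; _<_; _≤_; ≢-nonZero) renaming (_/_ to _//_)
open import Data.Rational.Properties using (_≟_; _<?_)
open import Data.Bool using (Bool; true; false; _∧_; _∨_; if_then_else_)
open import Data.Fin as Fin using (Fin)
open import Data.Fin.Properties as FinP using ()
open import Data.Maybe using (Maybe; just; nothing; is-just)
open import Data.Product using (Σ; _×_; _,_)
open import Data.Unit using (⊤; tt)
open import Data.List using (List; []; _∷_; map; foldr; concatMap; allFin; filterᵇ)
open import Data.Bool.ListAction using (any)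
open import Relation.Nullary using (yes; no; does)
open import Relation.Binary.PropositionalEquality using (refl)

ℕ→ℚ : ℕ → ℚ
ℕ→ℚ n = (+ n) // 1

-- totalised division (x / 0 := 0); all divisions used below have a
-- nonzero denominator under the hypotheses of the lemma
_/ℚ_ : ℚ → ℚ → ℚ
p /ℚ q with q ≟ 0ℚ
... | yes _  = 0ℚ
... | no q≢0 = _÷_ p q {{≢-nonZero q≢0}}

sumℚ : List ℚ → ℚ
sumℚ = foldr _+_ 0ℚ

countᵇ : {A : Set} → (A → Bool) → List A → ℕ
countᵇ p = foldr (λ a c → if p a then suc c else c) 0

-- Everything is parametrised by the sizes s j = |S_j| (j ≥ 1);
-- S_j is modelled as Fin (s j).  The value s 0 is never used.

module _ (s : ℕ → ℕ) where

  -- Q_k = S_1 × ⋯ × S_k, as nested (snoc) tuples; Q_0 = {()}.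
  Pt : ℕ → Set
  Pt zero    = ⊤
  Pt (suc k) = Pt k × Fin (s (suc k))

  pts : (k : ℕ) → List (Pt k)
  pts zero    = tt ∷ []
  pts (suc k) = concatMap (λ x → map (λ y → (x , y)) (allFin (s (suc k)))) (pts k)

  -- A hyperplane Y_1 × ⋯ × Y_k: coordinate j is either `just a`
  -- (Y_j = {a}, a fixed coordinate) or `nothing` (Y_j = S_j).
  Hyp : ℕ → Set
  Hyp zero    = ⊤
  Hyp (suc k) = Hyp k × Maybe (Fin (s (suc k)))

  -- subsets J of {1,…,k}, as a tuple of membership bits
  Sub : ℕ → Set
  Sub zero    = ⊤
  Sub (suc k) = Sub k × Bool

  subs : (k : ℕ) → List (Sub k)
  subs zero    = tt ∷ []
  subs (suc k) = concatMap (λ J → (J , false) ∷ (J , true) ∷ []) (subs k)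

  F : {k : ℕ} → Hyp k → Sub k
  F {zero}  tt      = tt
  F {suc k} (A , y) = (F A , is-just y)

  ‖_‖ : {k : ℕ} → Sub k → ℕ
  ‖_‖ {zero}  tt          = 1
  ‖_‖ {suc k} (J , false) = ‖ J ‖
  ‖_‖ {suc k} (J , true)  = ‖ J ‖ ℕ.* s (suc k)

  _∪_ : {k : ℕ} → Sub k → Sub k → Sub k
  _∪_ {zero}  tt       tt       = tt
  _∪_ {suc k} (J , a) (K , b) = (J ∪ K , a ∨ b)

  memᵇ : {k : ℕ} → Pt k → Hyp k → Bool
  memᵇ {zero}  tt      tt            = true
  memᵇ {suc k} (x , y) (A , nothing) = memᵇ x A
  memᵇ {suc k} (x , y) (A , just a)  = memᵇ x A ∧ does (y FinP.≟ a)

  -- top A = nothing if F(A) = ∅; otherwise just (max F(A) , projection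
  -- of A onto the first max F(A) coordinates)
  top : {k : ℕ} → Hyp k → Maybe (Σ ℕ Hyp)
  top {zero}  tt            = nothing
  top {suc k} (A , nothing) = top A
  top {suc k} (A , just a)  = just (suc k , (A , just a))

  inTop : {k : ℕ} → Pt k → Maybe (Σ ℕ Hyp) → Bool
  inTop x nothing = false
  inTop {k} x (just (k' , P)) with k' ℕ.≟ k
  ... | yes refl = memᵇ x P
  ... | no _     = false

  module _ {n : ℕ} (𝒜 : List (Hyp n)) where

    inB : (k : ℕ) → Pt k → Bool
    inB k x = any (λ A → inTop x (top A)) 𝒜

    -- α_k(x) for x ∈ Q_{k-1}; here k = suc m
    α : (m : ℕ) → Pt m → ℚ
    α m x = ℕ→ℚ (countᵇ (λ y → inB (suc m) (x , y)) (allFin (s (suc m))))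
            /ℚ ℕ→ℚ (s (suc m))

    module _ (δ : ℕ → ℚ) where

      w : (k : ℕ) → Pt k → ℚ
      w zero    tt      = 1ℚ
      w (suc m) (x , y) with does (δ (suc m) <? α m x)
      ... | false =
        if inB (suc m) (x , y) then 0ℚ
        else (1ℚ /ℚ (1ℚ - α m x)) * (w m x /ℚ ℕ→ℚ (s (suc m)))
      ... | true =
        if inB (suc m) (x , y)
        then ((α m x - δ (suc m)) /ℚ (α m x * (1ℚ - δ (suc m))))
             * (w m x /ℚ ℕ→ℚ (s (suc m)))
        else (1ℚ /ℚ (1ℚ - δ (suc m))) * (w m x /ℚ ℕ→ℚ (s (suc m)))

      E : ℕ → ℚ
      E m = sumℚ (map (λ x → α m x * α m x * w m x) (pts m))

  module _ (δ : ℕ → ℚ) where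

    prodTerm : {k : ℕ} → Sub k → ℚ
    prodTerm {zero}  tt          = 1ℚ
    prodTerm {suc k} (J , false) = prodTerm J
    prodTerm {suc k} (J , true)  =
      prodTerm J * (1ℚ /ℚ ((1ℚ - δ (suc k)) * ℕ→ℚ (s (suc k))))

    RHS : ℚ → ℕ → ℚ
    RHS C₀ k =
      (1ℚ /ℚ (ℕ→ℚ (s k) * ℕ→ℚ (s k))) *
      sumℚ (map (λ F₁ → sumℚ (map (λ F₂ → prodTerm (F₁ ∪ F₂)) good)) good)
      where
        good : List (Sub (k ℕ.∸ 1))
        good = filterᵇ (λ J → does ((C₀ /ℚ ℕ→ℚ (s k)) <? ℕ→ℚ ‖ J ‖)) (subs (k ℕ.∸ 1))

module Submission where

-- Fix k = m + 1. A point (x , y) ∈ B_k lies on the top slice (P , a) of some A ∈ 𝒜_k, and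
-- by non-parallelism A is determined by J = F(P) = F(A) ∖ {k}, where ‖J‖ > C₀ / |S_k|.
-- Hence |S_k| α_k(x) is at most the number of such J whose P_J ∋ x, and squaring and
-- summing against w_{k-1} reduces the claim to w_{k-1}(P_{J₁} ∩ P_{J₂}) ≤ ∏_{j ∈ J₁ ∪ J₂}
-- 1 / ((1 - δ_j) |S_j|). That holds by induction on the dimension, since w_j has w_{j-1}
-- as marginal and never exceeds w_{j-1} / ((1 - δ_j) |S_j|).

open import Defs
open import Data.Nat using (ℕ; _∸_; zero; suc) renaming (_≤_ to _≤ℕ_)
open import Data.Rational using (ℚ; 0ℚ; ½; _≤_; _<_)
open import Data.Product using (_×_)
open import Data.List using (List)
open import Data.List.Membership.Propositional using (_∈_)
open import Relation.Binary.PropositionalEquality using (_≡_)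

open import Data.Bool using (Bool; true; false; T; _∧_; _∨_; if_then_else_)
import Data.Bool.Properties as BoolP
open import Data.Empty using (⊥-elim; ⊥-elim-irr)
open import Data.Fin as Fin using (Fin)
import Data.Fin.Properties as FinP
open import Data.Integer as ℤ using ()
import Data.Integer.Properties as ℤP
open import Data.List using ([]; _∷_; map; concatMap; allFin; filterᵇ; length; _++_; tabulate)
import Data.List.Properties as ListP
open import Data.List.Membership.Propositional using (find; lose)
open import Data.List.Membership.Propositional.Properties using (∈-concatMap⁺; ∈-filter⁺)
open import Data.List.Relation.Unary.Any using (here; there; any?)
open import Data.List.Relation.Unary.Any.Properties using (any⁻)
open import Data.Maybe using (Maybe; just; nothing; is-just)
import Data.Maybe.Properties as MaybeP
import Data.Nat as ℕ
import Data.Nat.Properties as ℕP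
open import Data.Nat.Coprimality using (1-coprimeTo) renaming (sym to coprime-sym)
open import Data.Product using (Σ; _,_; proj₁; proj₂)
import Data.Product.Properties as ProductP
open import Data.Rational using (1ℚ; _+_; _*_; _-_; -_; 1/_; NonZero; Positive; positive; nonNegative; ≢-nonZero)
import Data.Rational.Properties as ℚP
open import Data.Rational.Solver using (module +-*-Solver)
open import Data.Unit using (tt)
import Data.Unit.Properties as UnitP
open import Function using (_∘_; Equivalence)
open import Relation.Binary.Definitions using (DecidableEquality)
open import Relation.Binary.PropositionalEquality using (refl; sym; trans; cong; cong₂; subst; subst₂; module ≡-Reasoning)
open import Relation.Nullary using (Dec; yes; no; does; proof)
open import Relation.Nullary.Reflects using (Reflects; invert)
open import Relation.Nullary.Decidable using (dec-true; T?; toWitness)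

open +-*-Solver

0≤1 : 0ℚ ≤ 1ℚ
0≤1 = ℚP.nonNegative⁻¹ 1ℚ

*-nonNeg : ∀ {p q} → 0ℚ ≤ p → 0ℚ ≤ q → 0ℚ ≤ p * q
*-nonNeg {p} {q} 0≤p 0≤q = ℚP.nonNegative⁻¹ (p * q)
  {{ℚP.nonNeg*nonNeg⇒nonNeg p {{nonNegative 0≤p}} q {{nonNegative 0≤q}}}}

*-monoˡ-≤ : ∀ {r p q} → 0ℚ ≤ r → p ≤ q → r * p ≤ r * q
*-monoˡ-≤ {r} 0≤r = ℚP.*-monoˡ-≤-nonNeg r {{nonNegative 0≤r}}

*-monoʳ-≤ : ∀ {r p q} → 0ℚ ≤ r → p ≤ q → p * r ≤ q * r
*-monoʳ-≤ {r} 0≤r = ℚP.*-monoʳ-≤-nonNeg r {{nonNegative 0≤r}}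

*-mono-≤ : ∀ {a b c d} → 0ℚ ≤ a → 0ℚ ≤ d → a ≤ b → c ≤ d → a * c ≤ b * d
*-mono-≤ 0≤a 0≤d a≤b c≤d = ℚP.≤-trans (*-monoˡ-≤ 0≤a c≤d) (*-monoʳ-≤ 0≤d a≤b)

p≤q⇒0≤q-p : ∀ {p q} → p ≤ q → 0ℚ ≤ q - p
p≤q⇒0≤q-p {p} h = ℚP.≤-trans (ℚP.≤-reflexive (sym (ℚP.+-inverseʳ p))) (ℚP.+-monoˡ-≤ (- p) h)

p<q⇒0<q-p : ∀ {p q} → p < q → 0ℚ < q - p
p<q⇒0<q-p {p} h = ℚP.≤-<-trans (ℚP.≤-reflexive (sym (ℚP.+-inverseʳ p))) (ℚP.+-monoˡ-< (- p) h)

ℕ→ℚ-suc : ∀ n → ℕ→ℚ (suc n) ≡ 1ℚ + ℕ→ℚ n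
ℕ→ℚ-suc n rewrite ℚP.normalize-coprime {n} {0} (coprime-sym (1-coprimeTo n)) =
  ℚP./-cong {p₁ = ℤ.+ suc n} {q₁ = 1} (cong (λ z → ℤ.+ 1 ℤ.+ z) (sym (ℤP.*-identityʳ (ℤ.+ n)))) refl

ℕ→ℚ-+ : ∀ a b → ℕ→ℚ (a ℕ.+ b) ≡ ℕ→ℚ a + ℕ→ℚ b
ℕ→ℚ-+ zero    b = sym (ℚP.+-identityˡ (ℕ→ℚ b))
ℕ→ℚ-+ (suc a) b = begin
  ℕ→ℚ (suc (a ℕ.+ b))          ≡⟨ ℕ→ℚ-suc (a ℕ.+ b) ⟩
  1ℚ + ℕ→ℚ (a ℕ.+ b)           ≡⟨ cong (1ℚ +_) (ℕ→ℚ-+ a b) ⟩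
  1ℚ + (ℕ→ℚ a + ℕ→ℚ b)         ≡⟨ ℚP.+-assoc 1ℚ (ℕ→ℚ a) (ℕ→ℚ b) ⟨
  (1ℚ + ℕ→ℚ a) + ℕ→ℚ b         ≡⟨ cong (_+ ℕ→ℚ b) (ℕ→ℚ-suc a) ⟨
  ℕ→ℚ (suc a) + ℕ→ℚ b          ∎
  where open ≡-Reasoning

ℕ→ℚ-* : ∀ a b → ℕ→ℚ (a ℕ.* b) ≡ ℕ→ℚ a * ℕ→ℚ b
ℕ→ℚ-* zero    b = sym (ℚP.*-zeroˡ (ℕ→ℚ b))
ℕ→ℚ-* (suc a) b = begin
  ℕ→ℚ (b ℕ.+ a ℕ.* b)          ≡⟨ ℕ→ℚ-+ b (a ℕ.* b) ⟩
  ℕ→ℚ b + ℕ→ℚ (a ℕ.* b)        ≡⟨ cong (ℕ→ℚ b +_) (ℕ→ℚ-* a b) ⟩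
  ℕ→ℚ b + ℕ→ℚ a * ℕ→ℚ b        ≡⟨ solve 2 (λ x y → y :+ x :* y := (con 1ℚ :+ x) :* y) refl (ℕ→ℚ a) (ℕ→ℚ b) ⟩
  (1ℚ + ℕ→ℚ a) * ℕ→ℚ b         ≡⟨ cong (_* ℕ→ℚ b) (ℕ→ℚ-suc a) ⟨
  ℕ→ℚ (suc a) * ℕ→ℚ b          ∎
  where open ≡-Reasoning

ℕ→ℚ-nonNeg : ∀ n → 0ℚ ≤ ℕ→ℚ n
ℕ→ℚ-nonNeg zero    = ℚP.≤-refl
ℕ→ℚ-nonNeg (suc n) rewrite ℕ→ℚ-suc n = ℚP.+-mono-≤ 0≤1 (ℕ→ℚ-nonNeg n)

ℕ→ℚ-mono-≤ : ∀ {a b} → a ≤ℕ b → ℕ→ℚ a ≤ ℕ→ℚ b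
ℕ→ℚ-mono-≤ {a} a≤b with ℕP.m≤n⇒∃[o]m+o≡n a≤b
... | d , refl rewrite ℕ→ℚ-+ a d =
  ℚP.≤-trans (ℚP.≤-reflexive (sym (ℚP.+-identityʳ (ℕ→ℚ a)))) (ℚP.+-monoʳ-≤ (ℕ→ℚ a) (ℕ→ℚ-nonNeg d))

ℕ→ℚ-pos : ∀ {n} → 1 ≤ℕ n → Positive (ℕ→ℚ n)
ℕ→ℚ-pos 1≤n = positive (ℚP.<-≤-trans (ℚP.positive⁻¹ 1ℚ) (ℕ→ℚ-mono-≤ 1≤n))

/ℚ-≡-*1/ : ∀ p q .{{_ : NonZero q}} → p /ℚ q ≡ p * 1/ q
/ℚ-≡-*1/ p q {{q≢0}} with q ℚP.≟ 0ℚ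
... | yes refl = ⊥-elim-irr (ℕ.NonZero.nonZero q≢0)
... | no _     = refl

/ℚ-*-cancel : ∀ p q .{{_ : Positive q}} → (p /ℚ q) * q ≡ p
/ℚ-*-cancel p q = begin
  (p /ℚ q) * q      ≡⟨ cong (_* q) (/ℚ-≡-*1/ p q) ⟩
  p * 1/ q * q      ≡⟨ ℚP.*-assoc p (1/ q) q ⟩
  p * (1/ q * q)    ≡⟨ cong (p *_) (ℚP.*-inverseˡ q) ⟩
  p * 1ℚ            ≡⟨ ℚP.*-identityʳ p ⟩
  p                 ∎
  where
  open ≡-Reasoning
  instance _ = ℚP.pos⇒nonZero q

/ℚ-unique : ∀ {p q r} .{{_ : Positive q}} → r * q ≡ p → p /ℚ q ≡ r
/ℚ-unique {p} {q} {r} rq≡p = begin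
  p /ℚ q            ≡⟨ /ℚ-≡-*1/ p q ⟩
  p * 1/ q          ≡⟨ cong (_* 1/ q) rq≡p ⟨
  r * q * 1/ q      ≡⟨ ℚP.*-assoc r q (1/ q) ⟩
  r * (q * 1/ q)    ≡⟨ cong (r *_) (ℚP.*-inverseʳ q) ⟩
  r * 1ℚ            ≡⟨ ℚP.*-identityʳ r ⟩
  r                 ∎
  where
  open ≡-Reasoning
  instance _ = ℚP.pos⇒nonZero q

/ℚ-≡-*1/ℚ : ∀ p q .{{_ : Positive q}} → p /ℚ q ≡ p * (1ℚ /ℚ q)
/ℚ-≡-*1/ℚ p q = /ℚ-unique (begin
  p * (1ℚ /ℚ q) * q   ≡⟨ ℚP.*-assoc p (1ℚ /ℚ q) q ⟩
  p * ((1ℚ /ℚ q) * q) ≡⟨ cong (p *_) (/ℚ-*-cancel 1ℚ q) ⟩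
  p * 1ℚ              ≡⟨ ℚP.*-identityʳ p ⟩
  p                   ∎)
  where open ≡-Reasoning

/ℚ-≤ : ∀ {p q r} .{{_ : Positive q}} → p ≤ r * q → p /ℚ q ≤ r
/ℚ-≤ {p} {q} p≤rq = ℚP.*-cancelʳ-≤-pos q (ℚP.≤-trans (ℚP.≤-reflexive (/ℚ-*-cancel p q)) p≤rq)

/ℚ-< : ∀ {p q r} .{{_ : Positive q}} → p < r * q → p /ℚ q < r
/ℚ-< {p} {q} p<rq =
  ℚP.*-cancelʳ-<-nonNeg q {{ℚP.pos⇒nonNeg q}} (ℚP.≤-<-trans (ℚP.≤-reflexive (/ℚ-*-cancel p q)) p<rq)

/ℚ-nonNeg : ∀ {p q} → 0ℚ ≤ p → 0ℚ ≤ q → 0ℚ ≤ p /ℚ q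
/ℚ-nonNeg {p} {q} 0≤p 0≤q with q ℚP.≟ 0ℚ
... | yes _   = ℚP.≤-refl
... | no q≢0  = *-nonNeg 0≤p (ℚP.<⇒≤ (ℚP.positive⁻¹ ((1/ q) {{≢-nonZero q≢0}}) {{ℚP.1/pos⇒pos q {{q-pos}}}}))
  where
  q-pos : Positive q
  q-pos = ℚP.nonNeg∧nonZero⇒pos q {{nonNegative 0≤q}} {{≢-nonZero q≢0}}

1/ℚ-* : ∀ p q .{{_ : Positive p}} .{{_ : Positive q}} → 1ℚ /ℚ (p * q) ≡ (1ℚ /ℚ p) * (1ℚ /ℚ q)
1/ℚ-* p q = /ℚ-unique {{ℚP.pos*pos⇒pos p q}} (begin
  (1ℚ /ℚ p) * (1ℚ /ℚ q) * (p * q)      ≡⟨ solve 4 (λ a b c d → a :* b :* (c :* d) := (a :* c) :* (b :* d)) refl (1ℚ /ℚ p) (1ℚ /ℚ q) p q ⟩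
  ((1ℚ /ℚ p) * p) * ((1ℚ /ℚ q) * q)    ≡⟨ cong₂ _*_ (/ℚ-*-cancel 1ℚ p) (/ℚ-*-cancel 1ℚ q) ⟩
  1ℚ * 1ℚ                              ≡⟨ ℚP.*-identityˡ 1ℚ ⟩
  1ℚ                                   ∎)
  where open ≡-Reasoning

∑ : {A : Set} → List A → (A → ℚ) → ℚ
∑ L f = sumℚ (map f L)

infix 5 ∑
syntax ∑ L (λ x → e) = ∑[ x ∈ L ] e

𝟙 : Bool → ℚ
𝟙 true  = 1ℚ
𝟙 false = 0ℚ

𝟙-nonNeg : ∀ b → 0ℚ ≤ 𝟙 b
𝟙-nonNeg true  = 0≤1
𝟙-nonNeg false = ℚP.≤-refl

𝟙-≤1 : ∀ b → 𝟙 b ≤ 1ℚ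
𝟙-≤1 true  = ℚP.≤-refl
𝟙-≤1 false = 0≤1

𝟙-≤ : ∀ b {q} → 0ℚ ≤ q → (T b → 1ℚ ≤ q) → 𝟙 b ≤ q
𝟙-≤ true  0≤q 1≤q = 1≤q tt
𝟙-≤ false 0≤q 1≤q = 0≤q

𝟙-∧ : ∀ a b → 𝟙 (a ∧ b) ≡ 𝟙 a * 𝟙 b
𝟙-∧ true  b = sym (ℚP.*-identityˡ (𝟙 b))
𝟙-∧ false b = sym (ℚP.*-zeroˡ (𝟙 b))

module _ {A : Set} where

  ∑-cong : ∀ (L : List A) {f g : A → ℚ} → (∀ x → f x ≡ g x) → ∑ L f ≡ ∑ L g
  ∑-cong []      f≡g = refl
  ∑-cong (x ∷ L) f≡g = cong₂ _+_ (f≡g x) (∑-cong L f≡g)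

  ∑-mono-≤ : ∀ (L : List A) {f g : A → ℚ} → (∀ x → f x ≤ g x) → ∑ L f ≤ ∑ L g
  ∑-mono-≤ []      f≤g = ℚP.≤-refl
  ∑-mono-≤ (x ∷ L) f≤g = ℚP.+-mono-≤ (f≤g x) (∑-mono-≤ L f≤g)

  ∑-nonNeg : ∀ (L : List A) {f : A → ℚ} → (∀ x → 0ℚ ≤ f x) → 0ℚ ≤ ∑ L f
  ∑-nonNeg []      0≤f = ℚP.≤-refl
  ∑-nonNeg (x ∷ L) 0≤f = ℚP.+-mono-≤ (0≤f x) (∑-nonNeg L 0≤f)

  ∑-zero : ∀ (L : List A) {f : A → ℚ} → (∀ x → f x ≡ 0ℚ) → ∑ L f ≡ 0ℚ
  ∑-zero []      f≡0 = refl
  ∑-zero (x ∷ L) f≡0 rewrite f≡0 x | ∑-zero L f≡0 = refl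

  ∑-+ : ∀ (L : List A) (f g : A → ℚ) → ∑[ x ∈ L ] (f x + g x) ≡ ∑ L f + ∑ L g
  ∑-+ []      f g = refl
  ∑-+ (x ∷ L) f g rewrite ∑-+ L f g =
    solve 4 (λ a b c d → (a :+ b) :+ (c :+ d) := (a :+ c) :+ (b :+ d)) refl (f x) (g x) (∑ L f) (∑ L g)

  ∑-*ˡ : ∀ c (L : List A) (f : A → ℚ) → ∑[ x ∈ L ] c * f x ≡ c * ∑ L f
  ∑-*ˡ c []      f = sym (ℚP.*-zeroʳ c)
  ∑-*ˡ c (x ∷ L) f rewrite ∑-*ˡ c L f = sym (ℚP.*-distribˡ-+ c (f x) (∑ L f))

  ∑-*ʳ : ∀ c (L : List A) (f : A → ℚ) → ∑[ x ∈ L ] f x * c ≡ ∑ L f * c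
  ∑-*ʳ c L f = begin
    ∑[ x ∈ L ] f x * c   ≡⟨ ∑-cong L (λ x → ℚP.*-comm (f x) c) ⟩
    ∑[ x ∈ L ] c * f x   ≡⟨ ∑-*ˡ c L f ⟩
    c * ∑ L f            ≡⟨ ℚP.*-comm c (∑ L f) ⟩
    ∑ L f * c            ∎
    where open ≡-Reasoning

  ∑-++ : ∀ (L M : List A) (f : A → ℚ) → ∑ (L ++ M) f ≡ ∑ L f + ∑ M f
  ∑-++ []      M f = sym (ℚP.+-identityˡ (∑ M f))
  ∑-++ (x ∷ L) M f rewrite ∑-++ L M f = sym (ℚP.+-assoc (f x) (∑ L f) (∑ M f))

  ∑-≥-term : ∀ {L : List A} {f : A → ℚ} {z} → (∀ x → 0ℚ ≤ f x) → z ∈ L → f z ≤ ∑ L f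
  ∑-≥-term {x ∷ L} {f} 0≤f (here refl) =
    ℚP.≤-trans (ℚP.≤-reflexive (sym (ℚP.+-identityʳ (f x)))) (ℚP.+-monoʳ-≤ (f x) (∑-nonNeg L 0≤f))
  ∑-≥-term {x ∷ L} {f} 0≤f (there z∈L) =
    ℚP.≤-trans (∑-≥-term 0≤f z∈L) (ℚP.≤-trans (ℚP.≤-reflexive (sym (ℚP.+-identityˡ _))) (ℚP.+-monoˡ-≤ _ (0≤f x)))

  countᵇ-≡-∑𝟙 : ∀ (p : A → Bool) (L : List A) → ℕ→ℚ (countᵇ p L) ≡ ∑[ x ∈ L ] 𝟙 (p x)
  countᵇ-≡-∑𝟙 p []      = refl
  countᵇ-≡-∑𝟙 p (x ∷ L) with p x
  ... | true  = trans (ℕ→ℚ-suc (countᵇ p L)) (cong (1ℚ +_) (countᵇ-≡-∑𝟙 p L))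
  ... | false = trans (countᵇ-≡-∑𝟙 p L) (sym (ℚP.+-identityˡ _))

  ∑-const : ∀ (L : List A) c → ∑[ _ ∈ L ] c ≡ ℕ→ℚ (length L) * c
  ∑-const []      c = sym (ℚP.*-zeroˡ c)
  ∑-const (x ∷ L) c = begin
    c + (∑[ _ ∈ L ] c)            ≡⟨ cong (c +_) (∑-const L c) ⟩
    c + ℕ→ℚ (length L) * c        ≡⟨ solve 2 (λ n c → c :+ n :* c := (con 1ℚ :+ n) :* c) refl (ℕ→ℚ (length L)) c ⟩
    (1ℚ + ℕ→ℚ (length L)) * c     ≡⟨ cong (_* c) (ℕ→ℚ-suc (length L)) ⟨
    ℕ→ℚ (suc (length L)) * c      ∎
    where open ≡-Reasoning

  ∑-∘-Bool : ∀ (f : Bool → ℚ) (p : A → Bool) (L : List A) →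
             ∑[ x ∈ L ] f (p x) ≡ ℕ→ℚ (length L) * f false + ℕ→ℚ (countᵇ p L) * (f true - f false)
  ∑-∘-Bool f p L = begin
    ∑[ x ∈ L ] f (p x)                                 ≡⟨ ∑-cong L (λ x → split (p x)) ⟩
    ∑[ x ∈ L ] (f false + 𝟙 (p x) * Δ)                 ≡⟨ ∑-+ L (λ _ → f false) (λ x → 𝟙 (p x) * Δ) ⟩
    (∑[ _ ∈ L ] f false) + (∑[ x ∈ L ] 𝟙 (p x) * Δ)     ≡⟨ cong₂ _+_ (∑-const L (f false)) (∑-*ʳ Δ L (𝟙 ∘ p)) ⟩
    ℕ→ℚ (length L) * f false + ∑ L (𝟙 ∘ p) * Δ         ≡⟨ cong (λ c → ℕ→ℚ (length L) * f false + c * Δ) (countᵇ-≡-∑𝟙 p L) ⟨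
    ℕ→ℚ (length L) * f false + ℕ→ℚ (countᵇ p L) * Δ    ∎
    where
    open ≡-Reasoning
    Δ = f true - f false
    split : ∀ b → f b ≡ f false + 𝟙 b * Δ
    split true  = solve 2 (λ t u → t := u :+ con 1ℚ :* (t :- u)) refl (f true) (f false)
    split false = solve 2 (λ t u → u := u :+ con 0ℚ :* (t :- u)) refl (f true) (f false)

∑-*-∑ : ∀ {A B : Set} (L : List A) (M : List B) (f : A → ℚ) (g : B → ℚ) →
        ∑ L f * ∑ M g ≡ ∑[ a ∈ L ] ∑[ b ∈ M ] f a * g b
∑-*-∑ []      M f g = ℚP.*-zeroˡ (∑ M g)
∑-*-∑ (x ∷ L) M f g
  rewrite ℚP.*-distribʳ-+ (∑ M g) (f x) (∑ L f) | ∑-*-∑ L M f g | ∑-*ˡ (f x) M g = refl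

module _ {A B : Set} where

  ∑-swap : ∀ (L : List A) (M : List B) (f : A → B → ℚ) →
           ∑[ a ∈ L ] ∑[ b ∈ M ] f a b ≡ ∑[ b ∈ M ] ∑[ a ∈ L ] f a b
  ∑-swap []      M f = sym (∑-zero M (λ _ → refl))
  ∑-swap (x ∷ L) M f rewrite ∑-swap L M f = sym (∑-+ M (f x) (λ b → ∑[ a ∈ L ] f a b))

  ∑-concatMap : ∀ (L : List A) (g : A → List B) (f : B → ℚ) → ∑ (concatMap g L) f ≡ ∑[ a ∈ L ] ∑ (g a) f
  ∑-concatMap []      g f = refl
  ∑-concatMap (x ∷ L) g f rewrite ∑-++ (g x) (concatMap g L) f | ∑-concatMap L g f = refl

  ∑-weighted-square : ∀ (X : List A) (L : List B) (f : A → B → ℚ) (w : A → ℚ) →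
                      ∑[ x ∈ X ] ∑ L (f x) * ∑ L (f x) * w x ≡ ∑[ b ∈ L ] ∑[ b′ ∈ L ] ∑[ x ∈ X ] f x b * f x b′ * w x
  ∑-weighted-square X L f w = begin
    ∑[ x ∈ X ] ∑ L (f x) * ∑ L (f x) * w x                 ≡⟨ ∑-cong X expand ⟩
    ∑[ x ∈ X ] ∑[ b ∈ L ] ∑[ b′ ∈ L ] f x b * f x b′ * w x  ≡⟨ ∑-swap X L _ ⟩
    ∑[ b ∈ L ] ∑[ x ∈ X ] ∑[ b′ ∈ L ] f x b * f x b′ * w x  ≡⟨ ∑-cong L (λ b → ∑-swap X L _) ⟩
    ∑[ b ∈ L ] ∑[ b′ ∈ L ] ∑[ x ∈ X ] f x b * f x b′ * w x  ∎
    where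
    open ≡-Reasoning
    expand : ∀ x → ∑ L (f x) * ∑ L (f x) * w x ≡ ∑[ b ∈ L ] ∑[ b′ ∈ L ] f x b * f x b′ * w x
    expand x = begin
      ∑ L (f x) * ∑ L (f x) * w x                    ≡⟨ cong (_* w x) (∑-*-∑ L L (f x) (f x)) ⟩
      (∑[ b ∈ L ] ∑[ b′ ∈ L ] f x b * f x b′) * w x  ≡⟨ ∑-*ʳ (w x) L (λ b → ∑[ b′ ∈ L ] f x b * f x b′) ⟨
      ∑[ b ∈ L ] (∑[ b′ ∈ L ] f x b * f x b′) * w x  ≡⟨ ∑-cong L (λ b → ∑-*ʳ (w x) L (λ b′ → f x b * f x b′)) ⟨
      ∑[ b ∈ L ] ∑[ b′ ∈ L ] f x b * f x b′ * w x    ∎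

∑-allFin-δ : ∀ {N} (a : Fin N) (f : Fin N → ℚ) → ∑[ y ∈ allFin N ] 𝟙 (does (y FinP.≟ a)) * f y ≡ f a
∑-allFin-δ {N} a f = trans (cong sumℚ (ListP.map-tabulate {n = N} (λ i → i) (λ y → 𝟙 (does (y FinP.≟ a)) * f y))) (tabulate-δ a f)
  where
  tabulate-zero : ∀ {M} (g : Fin M → ℚ) → (∀ y → g y ≡ 0ℚ) → sumℚ (tabulate g) ≡ 0ℚ
  tabulate-zero {zero}  g g≡0 = refl
  tabulate-zero {suc M} g g≡0 =
    trans (cong₂ _+_ (g≡0 Fin.zero) (tabulate-zero (g ∘ Fin.suc) (g≡0 ∘ Fin.suc))) (ℚP.+-identityˡ 0ℚ)
  tabulate-δ : ∀ {M} (a : Fin M) (f : Fin M → ℚ) → sumℚ (tabulate (λ y → 𝟙 (does (y FinP.≟ a)) * f y)) ≡ f a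
  tabulate-δ Fin.zero    f = trans (cong₂ _+_ (ℚP.*-identityˡ (f Fin.zero))
    (tabulate-zero _ (λ y → ℚP.*-zeroˡ (f (Fin.suc y))))) (ℚP.+-identityʳ (f Fin.zero))
  tabulate-δ (Fin.suc a) f = trans (cong₂ _+_ (ℚP.*-zeroˡ (f Fin.zero)) (tabulate-δ a (f ∘ Fin.suc)))
    (ℚP.+-identityˡ (f (Fin.suc a)))

length-allFin : ∀ N → length (allFin N) ≡ N
length-allFin N = ListP.length-tabulate {n = N} (λ i → i)

module Hyperplanes (s : ℕ → ℕ) where

  _≟Sub_ : ∀ {k} → DecidableEquality (Sub s k)
  _≟Sub_ {zero}  = UnitP._≟_
  _≟Sub_ {suc k} = ProductP.≡-dec _≟Sub_ BoolP._≟_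

  subs-complete : ∀ {k} (J : Sub s k) → J ∈ subs s k
  subs-complete {zero}  tt      = here refl
  subs-complete {suc k} (J , b) = ∈-concatMap⁺ (λ K → (K , false) ∷ (K , true) ∷ []) (lose (subs-complete J) (both b))
    where
    both : ∀ b → (J , b) ∈ (J , false) ∷ (J , true) ∷ []
    both false = here refl
    both true  = there (here refl)

  fits : ∀ {N} → Maybe (Fin N) → Fin N → Bool
  fits nothing  _ = true
  fits (just a) y = does (y FinP.≟ a)

  𝟙-memᵇ-snoc : ∀ {m} (x : Pt s m) y (P : Hyp s m) o → 𝟙 (memᵇ s (x , y) (P , o)) ≡ 𝟙 (memᵇ s x P) * 𝟙 (fits o y)
  𝟙-memᵇ-snoc x y P nothing  = trans (cong 𝟙 (sym (BoolP.∧-identityʳ (memᵇ s x P)))) (𝟙-∧ (memᵇ s x P) true)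
  𝟙-memᵇ-snoc x y P (just a) = 𝟙-∧ (memᵇ s x P) (does (y FinP.≟ a))

  topSlice : ∀ {k} → Hyp s k → (m : ℕ) → Maybe (Hyp s m × Fin (s (suc m)))
  topSlice {zero}  tt            m = nothing
  topSlice {suc k} (A , nothing) m = topSlice A m
  topSlice {suc k} (A , just a)  m with suc k ℕ.≟ suc m
  ... | yes refl = just (A , a)
  ... | no  _    = nothing

  sliceMem : ∀ {m} → Maybe (Hyp s m × Fin (s (suc m))) → Pt s (suc m) → Bool
  sliceMem nothing        _ = false
  sliceMem (just (P , a)) z = memᵇ s z (P , just a)

  sliceBase : ∀ {m} → Maybe (Hyp s m × Fin (s (suc m))) → Pt s m → Bool
  sliceBase nothing        _ = false
  sliceBase (just (P , _)) x = memᵇ s x P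

  inTop-topSlice : ∀ {k} (A : Hyp s k) m (z : Pt s (suc m)) → inTop s z (top s A) ≡ sliceMem (topSlice A m) z
  inTop-topSlice {zero}  tt            m z = refl
  inTop-topSlice {suc k} (A , nothing) m z = inTop-topSlice A m z
  inTop-topSlice {suc k} (A , just a)  m z with suc k ℕ.≟ suc m
  ... | yes refl = refl
  ... | no  _    = refl

  ∑-sliceMem : ∀ {m} v (x : Pt s m) → ∑[ y ∈ allFin (s (suc m)) ] 𝟙 (sliceMem v (x , y)) ≡ 𝟙 (sliceBase v x)
  ∑-sliceMem {m} nothing    x = ∑-zero (allFin (s (suc m))) (λ _ → refl)
  ∑-sliceMem {m} (just (P , a)) x = trans
    (∑-cong (allFin (s (suc m))) λ y → trans (𝟙-∧ (memᵇ s x P) (does (y FinP.≟ a))) (ℚP.*-comm (𝟙 (memᵇ s x P)) _))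
    (∑-allFin-δ a (λ _ → 𝟙 (memᵇ s x P)))

  topSlice-< : ∀ {k} (A : Hyp s k) m {v} → topSlice A m ≡ just v → m ℕ.< k
  topSlice-< {suc k} (A , nothing) m eq = ℕP.m<n⇒m<1+n (topSlice-< A m eq)
  topSlice-< {suc k} (A , just a)  m eq with suc k ℕ.≟ suc m
  topSlice-< {suc k} (A , just a)  m eq | yes refl = ℕP.n<1+n k
  topSlice-< {suc k} (A , just a)  m () | no  _

  topSlice-‖F‖ : ∀ {k} (A : Hyp s k) m {P a} → topSlice A m ≡ just (P , a) → ‖_‖ s (F s A) ≡ ‖_‖ s (F s P) ℕ.* s (suc m)
  topSlice-‖F‖ {suc k} (A , nothing) m eq = topSlice-‖F‖ A m eq
  topSlice-‖F‖ {suc k} (A , just a)  m eq with suc k ℕ.≟ suc m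
  topSlice-‖F‖ {suc k} (A , just a)  m refl | yes refl = refl
  topSlice-‖F‖ {suc k} (A , just a)  m ()   | no  _

  -- Two hyperplanes ending at the same coordinate m + 1 have F(A) = F(P) ∪ {m + 1}, so
  -- equal F on their top slices forces equal F.
  topSlice-F : ∀ {k} (A₁ A₂ : Hyp s k) m {v₁ v₂} → topSlice A₁ m ≡ just v₁ → topSlice A₂ m ≡ just v₂ →
               F s (proj₁ v₁) ≡ F s (proj₁ v₂) → F s A₁ ≡ F s A₂
  topSlice-F {suc k} (A₁ , nothing) (A₂ , nothing) m eq₁ eq₂ F≡ = cong (_, false) (topSlice-F A₁ A₂ m eq₁ eq₂ F≡)
  topSlice-F {suc k} (A₁ , nothing) (A₂ , just b) m eq₁ eq₂ F≡ with suc k ℕ.≟ suc m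
  topSlice-F {suc k} (A₁ , nothing) (A₂ , just b) m eq₁ eq₂ F≡ | yes refl = ⊥-elim (ℕP.<-irrefl refl (topSlice-< A₁ m eq₁))
  topSlice-F {suc k} (A₁ , nothing) (A₂ , just b) m eq₁ ()  F≡ | no  _
  topSlice-F {suc k} (A₁ , just b) (A₂ , nothing) m eq₁ eq₂ F≡ with suc k ℕ.≟ suc m
  topSlice-F {suc k} (A₁ , just b) (A₂ , nothing) m eq₁ eq₂ F≡ | yes refl = ⊥-elim (ℕP.<-irrefl refl (topSlice-< A₂ m eq₂))
  topSlice-F {suc k} (A₁ , just b) (A₂ , nothing) m ()  eq₂ F≡ | no  _
  topSlice-F {suc k} (A₁ , just b₁) (A₂ , just b₂) m eq₁ eq₂ F≡ with suc k ℕ.≟ suc m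
  topSlice-F {suc k} (A₁ , just b₁) (A₂ , just b₂) m refl refl F≡ | yes refl = cong (_, true) F≡
  topSlice-F {suc k} (A₁ , just b₁) (A₂ , just b₂) m ()   eq₂  F≡ | no  _

does-<?⇒< : ∀ {p q} → does (p ℚP.<? q) ≡ true → p < q
does-<?⇒< {p} {q} eq = invert (subst (Reflects (p < q)) eq (proof (p ℚP.<? q)))

does-<?⇒≥ : ∀ {p q} → does (p ℚP.<? q) ≡ false → q ≤ p
does-<?⇒≥ {p} {q} eq = ℚP.≮⇒≥ (invert (subst (Reflects (p < q)) eq (proof (p ℚP.<? q))))

-- w_k(x , y) = stepFactor (does (δ_k <? α_k(x))) δ_k α_k(x) [(x , y) ∈ B_k] · w_{k-1}(x) / |S_k|.
stepFactor : Bool → ℚ → ℚ → Bool → ℚ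
stepFactor false d a b = if b then 0ℚ else 1ℚ /ℚ (1ℚ - a)
stepFactor true  d a b = if b then (a - d) /ℚ (a * (1ℚ - d)) else 1ℚ /ℚ (1ℚ - d)

module _ {d : ℚ} (0≤d : 0ℚ ≤ d) (d<1 : d < 1ℚ) where

  private
    instance
      1-d-pos : Positive (1ℚ - d)
      1-d-pos = positive (p<q⇒0<q-p d<1)

    0≤1-d : 0ℚ ≤ 1ℚ - d
    0≤1-d = p≤q⇒0≤q-p (ℚP.<⇒≤ d<1)

    1-a-pos : ∀ {a} → a ≤ d → Positive (1ℚ - a)
    1-a-pos a≤d = positive (p<q⇒0<q-p (ℚP.≤-<-trans a≤d d<1))

    a-pos : ∀ {a} → d < a → Positive a
    a-pos d<a = positive (ℚP.≤-<-trans 0≤d d<a)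

  stepFactor-nonNeg : ∀ a b → 0ℚ ≤ stepFactor (does (d ℚP.<? a)) d a b
  stepFactor-nonNeg a b with does (d ℚP.<? a) in eq | b
  ... | false | true  = ℚP.≤-refl
  ... | false | false = /ℚ-nonNeg 0≤1 (ℚP.<⇒≤ (ℚP.positive⁻¹ (1ℚ - a) {{1-a-pos (does-<?⇒≥ {d} {a} eq)}}))
  ... | true  | true  = /ℚ-nonNeg (p≤q⇒0≤q-p (ℚP.<⇒≤ d<a)) (*-nonNeg (ℚP.<⇒≤ (ℚP.≤-<-trans 0≤d d<a)) 0≤1-d)
    where d<a = does-<?⇒< {d} {a} eq
  ... | true  | false = /ℚ-nonNeg 0≤1 0≤1-d

  stepFactor-≤ : ∀ a b → stepFactor (does (d ℚP.<? a)) d a b ≤ 1ℚ /ℚ (1ℚ - d)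
  stepFactor-≤ a b with does (d ℚP.<? a) in eq | b
  ... | false | true  = /ℚ-nonNeg 0≤1 0≤1-d
  ... | false | false = /ℚ-≤ {{1-a-pos a≤d}} (begin
      1ℚ                             ≡⟨ /ℚ-*-cancel 1ℚ (1ℚ - d) ⟨
      (1ℚ /ℚ (1ℚ - d)) * (1ℚ - d)    ≤⟨ *-monoˡ-≤ (/ℚ-nonNeg 0≤1 0≤1-d) (ℚP.+-monoʳ-≤ 1ℚ (ℚP.neg-antimono-≤ a≤d)) ⟩
      (1ℚ /ℚ (1ℚ - d)) * (1ℚ - a)    ∎)
    where
    open ℚP.≤-Reasoning
    a≤d = does-<?⇒≥ {d} {a} eq
  ... | true  | true  = /ℚ-≤ {{ℚP.pos*pos⇒pos a {{a-pos d<a}} (1ℚ - d)}} (begin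
      a - d                                ≤⟨ ℚP.+-monoʳ-≤ a (ℚP.neg-antimono-≤ 0≤d) ⟩
      a - 0ℚ                               ≡⟨ ℚP.+-identityʳ a ⟩
      a                                    ≡⟨ ℚP.*-identityʳ a ⟨
      a * 1ℚ                               ≡⟨ cong (a *_) (/ℚ-*-cancel 1ℚ (1ℚ - d)) ⟨
      a * ((1ℚ /ℚ (1ℚ - d)) * (1ℚ - d))    ≡⟨ solve 3 (λ a y e → a :* (y :* e) := y :* (a :* e)) refl a (1ℚ /ℚ (1ℚ - d)) (1ℚ - d) ⟩
      (1ℚ /ℚ (1ℚ - d)) * (a * (1ℚ - d))    ∎)
    where
    open ℚP.≤-Reasoning
    d<a = does-<?⇒< {d} {a} eq
  ... | true  | false = ℚP.≤-refl

  -- In both regimes the factors average to 1 over S_k (a |S_k| points in B_k, the rest outside),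
  -- so w_k has w_{k-1} as its marginal.
  stepFactor-mean : ∀ a → a * stepFactor (does (d ℚP.<? a)) d a true + (1ℚ - a) * stepFactor (does (d ℚP.<? a)) d a false ≡ 1ℚ
  stepFactor-mean a with does (d ℚP.<? a) in eq
  ... | false = begin
      a * 0ℚ + (1ℚ - a) * (1ℚ /ℚ (1ℚ - a))   ≡⟨ solve 2 (λ a y → a :* con 0ℚ :+ (con 1ℚ :- a) :* y := y :* (con 1ℚ :- a)) refl a (1ℚ /ℚ (1ℚ - a)) ⟩
      (1ℚ /ℚ (1ℚ - a)) * (1ℚ - a)            ≡⟨ /ℚ-*-cancel 1ℚ (1ℚ - a) {{1-a-pos (does-<?⇒≥ {d} {a} eq)}} ⟩
      1ℚ                                    ∎
    where open ≡-Reasoning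
  ... | true = begin
      a * ((a - d) /ℚ (a * (1ℚ - d))) + (1ℚ - a) * y
        ≡⟨ cong (λ z → a * z + (1ℚ - a) * y) (trans (/ℚ-≡-*1/ℚ (a - d) (a * (1ℚ - d)) {{a*e-pos}}) (cong ((a - d) *_) (1/ℚ-* a (1ℚ - d)))) ⟩
      a * ((a - d) * ((1ℚ /ℚ a) * y)) + (1ℚ - a) * y
        ≡⟨ solve 4 (λ a d ia y → a :* ((a :- d) :* (ia :* y)) :+ (con 1ℚ :- a) :* y
                                 := (ia :* a) :* ((a :- d) :* y) :+ (con 1ℚ :- a) :* y) refl a d (1ℚ /ℚ a) y ⟩
      ((1ℚ /ℚ a) * a) * ((a - d) * y) + (1ℚ - a) * y
        ≡⟨ cong (λ z → z * ((a - d) * y) + (1ℚ - a) * y) (/ℚ-*-cancel 1ℚ a) ⟩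
      1ℚ * ((a - d) * y) + (1ℚ - a) * y
        ≡⟨ solve 3 (λ a d y → con 1ℚ :* ((a :- d) :* y) :+ (con 1ℚ :- a) :* y := y :* (con 1ℚ :- d)) refl a d y ⟩
      y * (1ℚ - d)
        ≡⟨ /ℚ-*-cancel 1ℚ (1ℚ - d) ⟩
      1ℚ ∎
    where
    open ≡-Reasoning
    instance
      a-pos′ : Positive a
      a-pos′ = a-pos (does-<?⇒< {d} {a} eq)
    a*e-pos : Positive (a * (1ℚ - d))
    a*e-pos = ℚP.pos*pos⇒pos a (1ℚ - d)
    y = 1ℚ /ℚ (1ℚ - d)

if-*ʳ : ∀ b {p q u : ℚ} → (if b then p * u else q * u) ≡ (if b then p else q) * u
if-*ʳ true  = refl
if-*ʳ false = refl

if-0-*ʳ : ∀ b {q u : ℚ} → (if b then 0ℚ else q * u) ≡ (if b then 0ℚ else q) * u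
if-0-*ʳ true  {u = u} = sym (ℚP.*-zeroˡ u)
if-0-*ʳ false         = refl

module Weights (s : ℕ → ℕ) (s-pos : ∀ m → 1 ≤ℕ s (suc m))
               (δ : ℕ → ℚ) (δ-range : ∀ m → 0ℚ ≤ δ (suc m) × δ (suc m) < 1ℚ)
               {n : ℕ} (𝒜 : List (Hyp s n)) where

  open Hyperplanes s using (fits; 𝟙-memᵇ-snoc)

  card : ℕ → ℚ
  card m = ℕ→ℚ (s (suc m))

  instance
    card-pos : ∀ {m} → Positive (card m)
    card-pos {m} = ℕ→ℚ-pos (s-pos m)

  α-nonNeg : ∀ m x → 0ℚ ≤ α s 𝒜 m x
  α-nonNeg m x =
    /ℚ-nonNeg (ℕ→ℚ-nonNeg (countᵇ (λ y → inB s 𝒜 (suc m) (x , y)) (allFin (s (suc m))))) (ℕ→ℚ-nonNeg (s (suc m)))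

  coordFactor : ℕ → ℚ
  coordFactor m = 1ℚ /ℚ ((1ℚ - δ (suc m)) * card m)

  coordFactor-nonNeg : ∀ m → 0ℚ ≤ coordFactor m
  coordFactor-nonNeg m =
    /ℚ-nonNeg 0≤1 (*-nonNeg (p≤q⇒0≤q-p (ℚP.<⇒≤ (proj₂ (δ-range m)))) (ℕ→ℚ-nonNeg (s (suc m))))

  wt : (m : ℕ) → Pt s m → ℚ
  wt = w s 𝒜 δ

  w-step : ∀ m x y → wt (suc m) (x , y) ≡
           stepFactor (does (δ (suc m) ℚP.<? α s 𝒜 m x)) (δ (suc m)) (α s 𝒜 m x) (inB s 𝒜 (suc m) (x , y))
             * (wt m x /ℚ card m)
  w-step m x y with does (δ (suc m) ℚP.<? α s 𝒜 m x)
  ... | false = if-0-*ʳ (inB s 𝒜 (suc m) (x , y))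
  ... | true  = if-*ʳ (inB s 𝒜 (suc m) (x , y))

  w-nonNeg : ∀ m x → 0ℚ ≤ wt m x
  w-nonNeg zero    tt      = 0≤1
  w-nonNeg (suc m) (x , y) = subst (0ℚ ≤_) (sym (w-step m x y))
    (*-nonNeg (stepFactor-nonNeg (proj₁ (δ-range m)) (proj₂ (δ-range m)) (α s 𝒜 m x) (inB s 𝒜 (suc m) (x , y)))
              (/ℚ-nonNeg (w-nonNeg m x) (ℕ→ℚ-nonNeg (s (suc m)))))

  w-≤-coordFactor : ∀ m x y → wt (suc m) (x , y) ≤ coordFactor m * wt m x
  w-≤-coordFactor m x y = begin
    wt (suc m) (x , y)                            ≡⟨ w-step m x y ⟩
    stepFactor r d a b * (wt m x /ℚ card m)       ≤⟨ *-monoʳ-≤ (/ℚ-nonNeg (w-nonNeg m x) (ℕ→ℚ-nonNeg (s (suc m))))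
                                                       (stepFactor-≤ (proj₁ (δ-range m)) (proj₂ (δ-range m)) a b) ⟩
    (1ℚ /ℚ (1ℚ - d)) * (wt m x /ℚ card m)         ≡⟨ cong ((1ℚ /ℚ (1ℚ - d)) *_) (/ℚ-≡-*1/ℚ (wt m x) (card m)) ⟩
    (1ℚ /ℚ (1ℚ - d)) * (wt m x * (1ℚ /ℚ card m))  ≡⟨ solve 3 (λ e w c → e :* (w :* c) := (e :* c) :* w) refl (1ℚ /ℚ (1ℚ - d)) (wt m x) (1ℚ /ℚ card m) ⟩
    ((1ℚ /ℚ (1ℚ - d)) * (1ℚ /ℚ card m)) * wt m x  ≡⟨ cong (_* wt m x) (1/ℚ-* (1ℚ - d) (card m)) ⟨
    coordFactor m * wt m x                        ∎
    where
    open ℚP.≤-Reasoning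
    d = δ (suc m)
    a = α s 𝒜 m x
    r = does (d ℚP.<? a)
    b = inB s 𝒜 (suc m) (x , y)
    instance
      1-d-pos : Positive (1ℚ - d)
      1-d-pos = positive (p<q⇒0<q-p (proj₂ (δ-range m)))

  w-marginal : ∀ m x → ∑[ y ∈ allFin (s (suc m)) ] wt (suc m) (x , y) ≡ wt m x
  w-marginal m x = begin
    ∑[ y ∈ ys ] wt (suc m) (x , y)                ≡⟨ ∑-cong ys (w-step m x) ⟩
    ∑[ y ∈ ys ] φ (inY y) * u                     ≡⟨ ∑-*ʳ u ys (φ ∘ inY) ⟩
    ∑ ys (φ ∘ inY) * u                            ≡⟨ cong (_* u) (∑-∘-Bool φ inY ys) ⟩
    (ℕ→ℚ (length ys) * φ false + C * (φ true - φ false)) * u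
      ≡⟨ cong₂ (λ l c → (l * φ false + c * (φ true - φ false)) * u) (cong ℕ→ℚ (length-allFin (s (suc m))))
                                                                    (sym (/ℚ-*-cancel C (card m))) ⟩
    (card m * φ false + a * card m * (φ true - φ false)) * u
      ≡⟨ solve 5 (λ N a t f u → (N :* f :+ a :* N :* (t :- f)) :* u := (a :* t :+ (con 1ℚ :- a) :* f) :* (N :* u))
               refl (card m) a (φ true) (φ false) u ⟩
    (a * φ true + (1ℚ - a) * φ false) * (card m * u)
      ≡⟨ cong ((a * φ true + (1ℚ - a) * φ false) *_) (trans (ℚP.*-comm (card m) u) (/ℚ-*-cancel (wt m x) (card m))) ⟩
    (a * φ true + (1ℚ - a) * φ false) * wt m x
      ≡⟨ cong (_* wt m x) mean ⟩
    1ℚ * wt m x                                   ≡⟨ ℚP.*-identityˡ (wt m x) ⟩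
    wt m x                                        ∎
    where
    open ≡-Reasoning
    ys : List (Fin (s (suc m)))
    ys = allFin (s (suc m))
    inY : Fin (s (suc m)) → Bool
    inY y = inB s 𝒜 (suc m) (x , y)
    a u C : ℚ
    a = α s 𝒜 m x
    u = wt m x /ℚ card m
    C = ℕ→ℚ (countᵇ inY ys)
    φ : Bool → ℚ
    φ = stepFactor (does (δ (suc m) ℚP.<? a)) (δ (suc m)) a
    mean : a * φ true + (1ℚ - a) * φ false ≡ 1ℚ
    mean = stepFactor-mean (proj₁ (δ-range m)) (proj₂ (δ-range m)) a

  column-fixed-≤ : ∀ m x a → ∑[ y ∈ allFin (s (suc m)) ] 𝟙 (does (y FinP.≟ a)) * wt (suc m) (x , y) ≤ coordFactor m * wt m x
  column-fixed-≤ m x a = ℚP.≤-trans (ℚP.≤-reflexive (∑-allFin-δ a (λ y → wt (suc m) (x , y)))) (w-≤-coordFactor m x a)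

  column-≤ : ∀ m x (o₁ o₂ : Maybe (Fin (s (suc m)))) →
             ∑[ y ∈ allFin (s (suc m)) ] 𝟙 (fits o₁ y) * 𝟙 (fits o₂ y) * wt (suc m) (x , y)
             ≤ (if is-just o₁ ∨ is-just o₂ then coordFactor m else 1ℚ) * wt m x
  column-≤ m x nothing nothing = ℚP.≤-reflexive (begin
    ∑[ y ∈ ys ] 1ℚ * 1ℚ * wt (suc m) (x , y)   ≡⟨ ∑-cong ys (λ y → ℚP.*-identityˡ (wt (suc m) (x , y))) ⟩
    ∑[ y ∈ ys ] wt (suc m) (x , y)             ≡⟨ w-marginal m x ⟩
    wt m x                                     ≡⟨ ℚP.*-identityˡ (wt m x) ⟨
    1ℚ * wt m x                                ∎)
    where
    open ≡-Reasoning
    ys = allFin (s (suc m))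
  column-≤ m x (just a) o₂ = ℚP.≤-trans (∑-mono-≤ (allFin (s (suc m))) drop-o₂) (column-fixed-≤ m x a)
    where
    drop-o₂ : ∀ y → 𝟙 (fits (just a) y) * 𝟙 (fits o₂ y) * wt (suc m) (x , y) ≤ 𝟙 (fits (just a) y) * wt (suc m) (x , y)
    drop-o₂ y = *-monoʳ-≤ (w-nonNeg (suc m) (x , y)) (ℚP.≤-trans (*-monoˡ-≤ (𝟙-nonNeg (fits (just a) y)) (𝟙-≤1 (fits o₂ y)))
                                                                 (ℚP.≤-reflexive (ℚP.*-identityʳ (𝟙 (fits (just a) y)))))
  column-≤ m x nothing (just a) = ℚP.≤-trans (ℚP.≤-reflexive (∑-cong (allFin (s (suc m))) drop-o₁)) (column-fixed-≤ m x a)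
    where
    drop-o₁ : ∀ y → 1ℚ * 𝟙 (fits (just a) y) * wt (suc m) (x , y) ≡ 𝟙 (fits (just a) y) * wt (suc m) (x , y)
    drop-o₁ y = cong (_* wt (suc m) (x , y)) (ℚP.*-identityˡ (𝟙 (fits (just a) y)))

  prodTerm-nonNeg : ∀ {m} (J : Sub s m) → 0ℚ ≤ prodTerm s δ J
  prodTerm-nonNeg {zero}  tt          = 0≤1
  prodTerm-nonNeg {suc m} (J , false) = prodTerm-nonNeg J
  prodTerm-nonNeg {suc m} (J , true)  = *-nonNeg (prodTerm-nonNeg J) (coordFactor-nonNeg m)

  prodTerm-snoc : ∀ {m} (J : Sub s m) b → prodTerm s δ (J , b) ≡ prodTerm s δ J * (if b then coordFactor m else 1ℚ)
  prodTerm-snoc J true  = refl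
  prodTerm-snoc J false = sym (ℚP.*-identityʳ (prodTerm s δ J))

  mass : (m : ℕ) → (Pt s m → ℚ) → ℚ
  mass m f = ∑[ x ∈ pts s m ] f x * wt m x

  ∑-pts-suc : ∀ m (f : Pt s (suc m) → ℚ) → ∑ (pts s (suc m)) f ≡ ∑[ x ∈ pts s m ] ∑[ y ∈ allFin (s (suc m)) ] f (x , y)
  ∑-pts-suc m f = trans (∑-concatMap (pts s m) (λ x → map (x ,_) (allFin (s (suc m)))) f)
    (∑-cong (pts s m) λ x → cong sumℚ (sym (ListP.map-∘ (allFin (s (suc m))))))

  -- Summing out the last coordinate costs a factor 1 if it is free in both hyperplanes and
  -- at most coordFactor m if it is fixed in either.
  mass-∩-≤ : ∀ m (P₁ P₂ : Hyp s m) →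
             mass m (λ x → 𝟙 (memᵇ s x P₁) * 𝟙 (memᵇ s x P₂)) ≤ prodTerm s δ (_∪_ s (F s P₁) (F s P₂))
  mass-∩-≤ zero    tt        tt        = ℚP.≤-refl
  mass-∩-≤ (suc m) (Q₁ , o₁) (Q₂ , o₂) = begin
    mass (suc m) (λ z → 𝟙 (memᵇ s z (Q₁ , o₁)) * 𝟙 (memᵇ s z (Q₂ , o₂)))
      ≡⟨ ∑-pts-suc m _ ⟩
    ∑[ x ∈ pts s m ] ∑[ y ∈ ys ] 𝟙 (memᵇ s (x , y) (Q₁ , o₁)) * 𝟙 (memᵇ s (x , y) (Q₂ , o₂)) * wt (suc m) (x , y)
      ≡⟨ ∑-cong (pts s m) (λ x → trans (∑-cong ys (split x)) (∑-*ˡ (g x) ys (column x))) ⟩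
    ∑[ x ∈ pts s m ] g x * ∑ ys (column x)
      ≤⟨ ∑-mono-≤ (pts s m) (λ x → *-monoˡ-≤ (*-nonNeg (𝟙-nonNeg (memᵇ s x Q₁)) (𝟙-nonNeg (memᵇ s x Q₂))) (column-≤ m x o₁ o₂)) ⟩
    ∑[ x ∈ pts s m ] g x * (c * wt m x)
      ≡⟨ ∑-cong (pts s m) (λ x → solve 3 (λ g c w → g :* (c :* w) := c :* (g :* w)) refl (g x) c (wt m x)) ⟩
    ∑[ x ∈ pts s m ] c * (g x * wt m x)
      ≡⟨ ∑-*ˡ c (pts s m) (λ x → g x * wt m x) ⟩
    c * mass m g
      ≤⟨ *-monoˡ-≤ c-nonNeg (mass-∩-≤ m Q₁ Q₂) ⟩
    c * prodTerm s δ (_∪_ s (F s Q₁) (F s Q₂))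
      ≡⟨ trans (ℚP.*-comm c _) (sym (prodTerm-snoc (_∪_ s (F s Q₁) (F s Q₂)) (is-just o₁ ∨ is-just o₂))) ⟩
    prodTerm s δ (_∪_ s (F s (Q₁ , o₁)) (F s (Q₂ , o₂)))
      ∎
    where
    open ℚP.≤-Reasoning
    ys : List (Fin (s (suc m)))
    ys = allFin (s (suc m))
    g : Pt s m → ℚ
    g x = 𝟙 (memᵇ s x Q₁) * 𝟙 (memᵇ s x Q₂)
    c : ℚ
    c = if is-just o₁ ∨ is-just o₂ then coordFactor m else 1ℚ
    c-nonNeg : 0ℚ ≤ c
    c-nonNeg with is-just o₁ ∨ is-just o₂
    ... | true  = coordFactor-nonNeg m
    ... | false = 0≤1
    column : Pt s m → Fin (s (suc m)) → ℚ
    column x y = 𝟙 (fits o₁ y) * 𝟙 (fits o₂ y) * wt (suc m) (x , y)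
    split : ∀ x y → 𝟙 (memᵇ s (x , y) (Q₁ , o₁)) * 𝟙 (memᵇ s (x , y) (Q₂ , o₂)) * wt (suc m) (x , y) ≡ g x * column x y
    split x y = begin-equality
      𝟙 (memᵇ s (x , y) (Q₁ , o₁)) * 𝟙 (memᵇ s (x , y) (Q₂ , o₂)) * wt (suc m) (x , y)
        ≡⟨ cong₂ (λ p q → p * q * wt (suc m) (x , y)) (𝟙-memᵇ-snoc x y Q₁ o₁) (𝟙-memᵇ-snoc x y Q₂ o₂) ⟩
      𝟙 (memᵇ s x Q₁) * 𝟙 (fits o₁ y) * (𝟙 (memᵇ s x Q₂) * 𝟙 (fits o₂ y)) * wt (suc m) (x , y)
        ≡⟨ solve 5 (λ a k b l w → a :* k :* (b :* l) :* w := a :* b :* (k :* l :* w)) refl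
             (𝟙 (memᵇ s x Q₁)) (𝟙 (fits o₁ y)) (𝟙 (memᵇ s x Q₂)) (𝟙 (fits o₂ y)) (wt (suc m) (x , y)) ⟩
      g x * column x y ∎

-- Among pairwise non-parallel hyperplanes at most one ends at coordinate m + 1 with given
-- remaining fixed coordinates J; theSlice J is its top slice, if there is one.
module UniqueSlices (s : ℕ → ℕ) {n : ℕ} (𝒜 : List (Hyp s n))
                    (nonParallel : ∀ A A′ → A ∈ 𝒜 → A′ ∈ 𝒜 → F s A ≡ F s A′ → A ≡ A′) (m : ℕ) where

  open Hyperplanes s

  Slice : Set
  Slice = Hyp s m × Fin (s (suc m))

  HasSlice : Sub s m → Hyp s n → Set
  HasSlice J A = Σ Slice λ v → topSlice A m ≡ just v × F s (proj₁ v) ≡ J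

  hasSlice? : ∀ J A → Dec (HasSlice J A)
  hasSlice? J A with topSlice A m
  ... | nothing = no λ { (_ , () , _) }
  ... | just (P , a) with F s P ≟Sub J
  ...   | yes FP≡J = yes ((P , a) , refl , FP≡J)
  ...   | no  FP≢J = no λ { (_ , refl , FP≡J) → FP≢J FP≡J }

  theSlice : Sub s m → Maybe Slice
  theSlice J with any? (hasSlice? J) 𝒜
  ... | yes p = just (proj₁ (proj₂ (proj₂ (find p))))
  ... | no  _ = nothing

  theSlice-sound : ∀ J {v} → theSlice J ≡ just v → F s (proj₁ v) ≡ J
  theSlice-sound J eq with any? (hasSlice? J) 𝒜
  ... | yes p with find p
  ...   | _ , _ , _ , _ , F≡J = subst (λ v → F s (proj₁ v) ≡ J) (MaybeP.just-injective eq) F≡J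

  theSlice-complete : ∀ {A v} → A ∈ 𝒜 → topSlice A m ≡ just v → theSlice (F s (proj₁ v)) ≡ just v
  theSlice-complete {A} {v} A∈𝒜 slice≡v with any? (hasSlice? (F s (proj₁ v))) 𝒜
  ... | no  ¬any = ⊥-elim (¬any (lose A∈𝒜 (v , slice≡v , refl)))
  ... | yes p with find p
  ...   | A′ , A′∈𝒜 , v′ , slice≡v′ , F≡ = cong just (MaybeP.just-injective (begin
      just v′            ≡⟨ slice≡v′ ⟨
      topSlice A′ m      ≡⟨ cong (λ B → topSlice B m) (nonParallel A′ A A′∈𝒜 A∈𝒜 (topSlice-F A′ A m slice≡v′ slice≡v F≡)) ⟩
      topSlice A m       ≡⟨ slice≡v ⟩
      just v             ∎))
    where open ≡-Reasoning

module Covering (s : ℕ → ℕ) (s-pos : ∀ m → 1 ≤ℕ s (suc m))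
                (δ : ℕ → ℚ) (δ-range : ∀ m → 0ℚ ≤ δ (suc m) × δ (suc m) < 1ℚ)
                {n : ℕ} (𝒜 : List (Hyp s n))
                (nonParallel : ∀ A A′ → A ∈ 𝒜 → A′ ∈ 𝒜 → F s A ≡ F s A′ → A ≡ A′)
                (C₀ : ℚ) (large : ∀ A → A ∈ 𝒜 → C₀ < ℕ→ℚ (‖_‖ s (F s A)))
                (m : ℕ) where

  open Weights s s-pos δ δ-range 𝒜
  open Hyperplanes s
  open UniqueSlices s 𝒜 nonParallel m

  isLarge : Sub s m → Bool
  isLarge J = does ((C₀ /ℚ ℕ→ℚ (s (suc m))) ℚP.<? ℕ→ℚ (‖_‖ s J))

  largeSubs : List (Sub s m)
  largeSubs = filterᵇ isLarge (subs s m)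

  topSlice-large : ∀ {A P a} → A ∈ 𝒜 → topSlice A m ≡ just (P , a) → F s P ∈ largeSubs
  topSlice-large {A} {P} A∈𝒜 slice≡ = ∈-filter⁺ (T? ∘ isLarge) (subs-complete (F s P))
    (Equivalence.from BoolP.T-≡ (dec-true ((C₀ /ℚ card m) ℚP.<? ℕ→ℚ (‖_‖ s (F s P))) (/ℚ-< (begin-strict
      C₀                                    <⟨ large A A∈𝒜 ⟩
      ℕ→ℚ (‖_‖ s (F s A))                   ≡⟨ cong ℕ→ℚ (topSlice-‖F‖ A m slice≡) ⟩
      ℕ→ℚ (‖_‖ s (F s P) ℕ.* s (suc m))      ≡⟨ ℕ→ℚ-* (‖_‖ s (F s P)) (s (suc m)) ⟩
      ℕ→ℚ (‖_‖ s (F s P)) * card m          ∎))))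
    where open ℚP.≤-Reasoning

  -- Each point of B_{m+1} lies in the top slice of some A ∈ 𝒜, which is theSlice (F P).
  𝟙-inB-≤ : ∀ x y → 𝟙 (inB s 𝒜 (suc m) (x , y)) ≤ ∑[ J ∈ largeSubs ] 𝟙 (sliceMem (theSlice J) (x , y))
  𝟙-inB-≤ x y = 𝟙-≤ (inB s 𝒜 (suc m) (x , y)) (∑-nonNeg largeSubs (λ J → 𝟙-nonNeg (sliceMem (theSlice J) (x , y)))) covered
    where
    S : ℚ
    S = ∑[ J ∈ largeSubs ] 𝟙 (sliceMem (theSlice J) (x , y))
    covered : T (inB s 𝒜 (suc m) (x , y)) → 1ℚ ≤ S
    covered in-B with find (any⁻ (λ A → inTop s (x , y) (top s A)) 𝒜 in-B)
    ... | A , A∈𝒜 , in-A = hit (topSlice A m) refl (subst T (inTop-topSlice A m (x , y)) in-A)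
      where
      hit : ∀ v → topSlice A m ≡ v → T (sliceMem v (x , y)) → 1ℚ ≤ S
      hit (just v) slice≡v in-v = ℚP.≤-trans (ℚP.≤-reflexive (cong 𝟙 (sym in-theSlice)))
        (∑-≥-term (λ J → 𝟙-nonNeg (sliceMem (theSlice J) (x , y))) (topSlice-large A∈𝒜 slice≡v))
        where
        in-theSlice : sliceMem (theSlice (F s (proj₁ v))) (x , y) ≡ true
        in-theSlice = trans (cong (λ u → sliceMem u (x , y)) (theSlice-complete A∈𝒜 slice≡v)) (Equivalence.to BoolP.T-≡ in-v)

  sliceCount : Pt s m → ℚ
  sliceCount x = ∑[ J ∈ largeSubs ] 𝟙 (sliceBase (theSlice J) x)

  α-≤ : ∀ x → α s 𝒜 m x ≤ sliceCount x * (1ℚ /ℚ card m)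
  α-≤ x = begin
    α s 𝒜 m x                                                 ≡⟨ /ℚ-≡-*1/ℚ (ℕ→ℚ (countᵇ inY ys)) (card m) ⟩
    ℕ→ℚ (countᵇ inY ys) * (1ℚ /ℚ card m)                      ≤⟨ *-monoʳ-≤ (/ℚ-nonNeg 0≤1 (ℕ→ℚ-nonNeg (s (suc m)))) count-≤ ⟩
    sliceCount x * (1ℚ /ℚ card m)                             ∎
    where
    open ℚP.≤-Reasoning
    ys : List (Fin (s (suc m)))
    ys = allFin (s (suc m))
    inY : Fin (s (suc m)) → Bool
    inY y = inB s 𝒜 (suc m) (x , y)
    count-≤ : ℕ→ℚ (countᵇ inY ys) ≤ sliceCount x
    count-≤ = begin
      ℕ→ℚ (countᵇ inY ys)                                               ≡⟨ countᵇ-≡-∑𝟙 inY ys ⟩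
      ∑[ y ∈ ys ] 𝟙 (inY y)                                             ≤⟨ ∑-mono-≤ ys (𝟙-inB-≤ x) ⟩
      ∑[ y ∈ ys ] ∑[ J ∈ largeSubs ] 𝟙 (sliceMem (theSlice J) (x , y))  ≡⟨ ∑-swap ys largeSubs _ ⟩
      ∑[ J ∈ largeSubs ] ∑[ y ∈ ys ] 𝟙 (sliceMem (theSlice J) (x , y))  ≡⟨ ∑-cong largeSubs (λ J → ∑-sliceMem (theSlice J) x) ⟩
      sliceCount x                                                      ∎

  slice-mass-≤ : ∀ J₁ J₂ → mass m (λ x → 𝟙 (sliceBase (theSlice J₁) x) * 𝟙 (sliceBase (theSlice J₂) x))
                           ≤ prodTerm s δ (_∪_ s J₁ J₂)
  slice-mass-≤ J₁ J₂ = bound (theSlice J₁) (theSlice J₂) (theSlice-sound J₁) (theSlice-sound J₂)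
    where
    empty : ∀ {f : Pt s m → ℚ} → (∀ x → f x ≡ 0ℚ) → mass m f ≤ prodTerm s δ (_∪_ s J₁ J₂)
    empty {f} f≡0 = ℚP.≤-trans
      (ℚP.≤-reflexive (∑-zero (pts s m) λ x → trans (cong (_* wt m x) (f≡0 x)) (ℚP.*-zeroˡ (wt m x))))
      (prodTerm-nonNeg (_∪_ s J₁ J₂))
    bound : ∀ v₁ v₂ → (∀ {v} → v₁ ≡ just v → F s (proj₁ v) ≡ J₁) → (∀ {v} → v₂ ≡ just v → F s (proj₁ v) ≡ J₂) →
            mass m (λ x → 𝟙 (sliceBase v₁ x) * 𝟙 (sliceBase v₂ x)) ≤ prodTerm s δ (_∪_ s J₁ J₂)
    bound nothing         v₂              _    _    = empty (λ x → ℚP.*-zeroˡ (𝟙 (sliceBase v₂ x)))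
    bound (just v₁)       nothing         _    _    = empty (λ x → ℚP.*-zeroʳ (𝟙 (sliceBase (just v₁) x)))
    bound (just (P₁ , _)) (just (P₂ , _)) F≡J₁ F≡J₂ =
      subst₂ (λ K L → _ ≤ prodTerm s δ (_∪_ s K L)) (F≡J₁ refl) (F≡J₂ refl) (mass-∩-≤ m P₁ P₂)

  E-≤-RHS : E s 𝒜 δ m ≤ RHS s δ C₀ (suc m)
  E-≤-RHS = begin
    mass m (λ x → α s 𝒜 m x * α s 𝒜 m x)
      ≤⟨ ∑-mono-≤ (pts s m) (λ x → *-monoʳ-≤ (w-nonNeg m x) (*-mono-≤ (α-nonNeg m x) (Su-nonNeg x) (α-≤ x) (α-≤ x))) ⟩
    mass m (λ x → (sliceCount x * u) * (sliceCount x * u))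
      ≡⟨ ∑-cong (pts s m) (λ x → solve 3 (λ S u w → S :* u :* (S :* u) :* w := u :* u :* (S :* S :* w)) refl (sliceCount x) u (wt m x)) ⟩
    ∑[ x ∈ pts s m ] u * u * (sliceCount x * sliceCount x * wt m x)
      ≡⟨ ∑-*ˡ (u * u) (pts s m) (λ x → sliceCount x * sliceCount x * wt m x) ⟩
    u * u * mass m (λ x → sliceCount x * sliceCount x)
      ≡⟨ cong (u * u *_) (∑-weighted-square (pts s m) largeSubs (λ x J → 𝟙 (sliceBase (theSlice J) x)) (wt m)) ⟩
    u * u * (∑[ J₁ ∈ largeSubs ] ∑[ J₂ ∈ largeSubs ] mass m (λ x → 𝟙 (sliceBase (theSlice J₁) x) * 𝟙 (sliceBase (theSlice J₂) x)))
      ≤⟨ *-monoˡ-≤ (*-nonNeg u-nonNeg u-nonNeg) (∑-mono-≤ largeSubs λ J₁ → ∑-mono-≤ largeSubs λ J₂ → slice-mass-≤ J₁ J₂) ⟩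
    u * u * (∑[ J₁ ∈ largeSubs ] ∑[ J₂ ∈ largeSubs ] prodTerm s δ (_∪_ s J₁ J₂))
      ≡⟨ cong (_* (∑[ J₁ ∈ largeSubs ] ∑[ J₂ ∈ largeSubs ] prodTerm s δ (_∪_ s J₁ J₂))) (1/ℚ-* (card m) (card m)) ⟨
    RHS s δ C₀ (suc m)
      ∎
    where
    open ℚP.≤-Reasoning
    u : ℚ
    u = 1ℚ /ℚ card m
    u-nonNeg : 0ℚ ≤ u
    u-nonNeg = /ℚ-nonNeg 0≤1 (ℕ→ℚ-nonNeg (s (suc m)))
    Su-nonNeg : ∀ x → 0ℚ ≤ sliceCount x * u
    Su-nonNeg x = ℚP.≤-trans (α-nonNeg m x) (α-≤ x)

lemma5 : (s : ℕ → ℕ) → (∀ j → 1 ≤ℕ j → 2 ≤ℕ s j)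
    → (δ : ℕ → ℚ) → (∀ j → 1 ≤ℕ j → (0ℚ ≤ δ j) × (δ j ≤ ½))
    → (n : ℕ) → 1 ≤ℕ n
    → (C₀ : ℚ) → 0ℚ ≤ C₀
    → (𝒜 : List (Hyp s n))
    → (∀ A A′ → A ∈ 𝒜 → A′ ∈ 𝒜 → F s A ≡ F s A′ → A ≡ A′)
    → (∀ A → A ∈ 𝒜 → C₀ < ℕ→ℚ (‖_‖ s (F s A)))
    → (k : ℕ) → 1 ≤ℕ k → k ≤ℕ n
    → E s 𝒜 δ (k ∸ 1) ≤ RHS s δ C₀ k
lemma5 s s≥2 δ δ∈[0,½] _ _ C₀ _ 𝒜 nonParallel large (suc m) _ _ =
  Covering.E-≤-RHS s s-pos δ δ-range 𝒜 nonParallel C₀ large m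
  where
  s-pos : ∀ m → 1 ≤ℕ s (suc m)
  s-pos m = ℕP.≤-trans (ℕP.n≤1+n 1) (s≥2 (suc m) (ℕ.s≤s ℕ.z≤n))
  δ-range : ∀ m → 0ℚ ≤ δ (suc m) × δ (suc m) < 1ℚ
  δ-range m = proj₁ (δ∈[0,½] (suc m) (ℕ.s≤s ℕ.z≤n)) ,
              ℚP.≤-<-trans (proj₂ (δ∈[0,½] (suc m) (ℕ.s≤s ℕ.z≤n))) (toWitness {a? = ½ ℚP.<? 1ℚ} tt)
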